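{- For fixed nonnegative integers $p,q$, the set of forbidden induced subgraphs for the class of $(p,q)$-edge-split graphs is finite.
   Context: All graphs are simple, finite and undirected. A forbidden induced subgraph for a hereditary class (a class closed under taking induced subgraphs) is a graph not in the class all of whose proper induced subgraphs are in the class. A graph $G$ is a $(p,q)$-edge-split graph if $V(G)$ can be partitioned into sets $V_1$ and $V_2$ such that $G[V_1]$ can be obtained from a complete graph by deleting at most $p$ edges and $G[V_2]$ has at most $q$ edges. -}

module Defs where

open import Data.Nat using (ℕ; zero; suc; _+_; _≤_; _<_; _<ᵇ_)
open import Data.Fin using (Fin; toℕ) renaming (zero to fzero; suc to fsuc)
open import Data.Bool using (Bool; true; false; _∧_; not; if_then_else_)
open import Data.Product using (Σ; ∃; _×_; _,_; proj₂)
open import Data.List using (List)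
open import Data.List.Membership.Propositional using (_∈_)
open import Relation.Binary.PropositionalEquality using (_≡_)
open import Relation.Nullary using (¬_)
open import Function using (_∘_)
open import Function.Definitions using (Injective; Bijective)

record Graph (n : ℕ) : Set where
  field
    adj    : Fin n → Fin n → Bool
    sym    : ∀ i j → adj i j ≡ adj j i
    irrefl : ∀ i → adj i i ≡ false
open Graph public

AnyGraph : Set
AnyGraph = Σ ℕ Graph

_≅_ : ∀ {n m} → Graph n → Graph m → Set
_≅_ {n} {m} G H =
  Σ (Fin n → Fin m) λ f → Bijective _≡_ _≡_ f × (∀ i j → adj H (f i) (f j) ≡ adj G i j)

IsInducedSub : ∀ {m n} → Graph m → Graph n → Set
IsInducedSub {m} {n} H G =
  Σ (Fin m → Fin n) λ f → Injective _≡_ _≡_ f × (∀ i j → adj G (f i) (f j) ≡ adj H i j)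

IsProperInducedSub : ∀ {m n} → Graph m → Graph n → Set
IsProperInducedSub {m} {n} H G = m < n × IsInducedSub H G

GraphClass : Set₁
GraphClass = ∀ {n} → Graph n → Set

-- Minimal forbidden induced subgraph of a (hereditary) class.
IsForbidden : GraphClass → ∀ {n} → Graph n → Set
IsForbidden C {n} G =
  ¬ C G × (∀ {m} (H : Graph m) → IsProperInducedSub H G → C H)

sumFin : ∀ {n} → (Fin n → ℕ) → ℕ
sumFin {zero}  f = 0
sumFin {suc n} f = f fzero + sumFin (f ∘ fsuc)

countPairs : ∀ {n} → (Fin n → Fin n → Bool) → ℕ
countPairs P = sumFin λ i → sumFin λ j →
  if (toℕ i <ᵇ toℕ j) ∧ P i j then 1 else 0

-- (p,q)-edge-split: a partition V1 (inV1 = true), V2 (inV1 = false) with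
-- G[V1] missing at most p edges of the complete graph on V1 and
-- G[V2] having at most q edges.
EdgeSplit : ℕ → ℕ → GraphClass
EdgeSplit p q {n} G =
  Σ (Fin n → Bool) λ inV1 →
    countPairs (λ i j → inV1 i ∧ inV1 j ∧ not (adj G i j)) ≤ p ×
    countPairs (λ i j → not (inV1 i) ∧ not (inV1 j) ∧ adj G i j) ≤ q

FinitelyManyForbidden : GraphClass → Set
FinitelyManyForbidden C =
  Σ (List AnyGraph) λ L →
    ∀ {n} (G : Graph n) → IsForbidden C G →
      Σ AnyGraph λ H → (H ∈ L) × (G ≅ proj₂ H)

-- Let G be a minimal graph that is not (p,q)-edge-split, and for each vertex w let V w be the
-- first part of a (p,q)-edge-split partition of G − w. Away from w and w′, any two vertices lying
-- in V w but not in V w′ span a non-edge inside V w or an edge outside V w′, so there are at most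
-- p + q + 1 of them; hence all the sets V 0 △ V w are small. A sunflower-type selection then gives
-- a set Q and many vertices w (the petals) such that every vertex x lies in {w} ∪ (Q △ V w) for
-- only few petals w. A non-edge inside Q (an edge outside Q) is thus a non-edge inside V w (an edge
-- outside V w) of G − w for most petals w, and double counting shows that Q has at most p such
-- non-edges and q such edges. As G is not (p,q)-edge-split, it must have fewer than orderBound p q
-- vertices, and up to isomorphism there are only finitely many graphs of bounded order.

module Submission where

open import Defs renaming (sym to adj-sym)
open import Data.Bool using (Bool; true; false; _∧_; _∨_; not; if_then_else_; _xor_)
open import Data.Bool.Properties using (∧-comm; ∧-zeroʳ; ∧-identityʳ; ∧-idem; xor-assoc)
open import Data.Fin using (Fin; toℕ; punchIn) renaming (zero to fzero; suc to fsuc)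
open import Data.Fin.Properties using (_≟_; any?; punchIn-injective)
open import Data.Vec.Functional as Vector using (Vector; insertAt)
open import Data.Vec.Functional.Properties using (insertAt-punchIn)
open import Data.Nat using (ℕ; zero; suc; _+_; _*_; _≤_; _<_; _<ᵇ_; z≤n; s≤s; s≤s⁻¹; _≤?_)
open import Data.Nat.Properties
  using ( ≤-refl; ≤-trans; ≤-reflexive; <-irrefl; ≤-<-trans; <⇒≤; ≰⇒>; ≮⇒≥; _<?_; n<1+n
        ; m≤m+n; m≤n+m; m≤n*m; m≤n⇒∃[o]m+o≡n; +-comm; +-suc; +-identityʳ; +-cancelˡ-≤
        ; +-mono-≤; +-monoˡ-≤; +-monoʳ-≤; *-comm; *-assoc; *-suc; *-distribˡ-+
        ; *-monoˡ-≤; *-monoʳ-≤; *-monoˡ-<; +-*-semiring; module ≤-Reasoning )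
open import Algebra.Properties.Semiring.Sum +-*-semiring
  using (sum; ∑-distrib-+; ∑-comm; sum-remove; *-distribˡ-sum; *-distribʳ-sum)
open import Data.List using (List; [_]; _∷_; []; map; concatMap; cartesianProductWith; upTo)
open import Data.List.Membership.Propositional using (_∈_; lose)
open import Data.List.Membership.Propositional.Properties
  using (∈-map⁺; ∈-concatMap⁺; ∈-cartesianProductWith⁺; ∈-upTo⁺)
open import Data.List.Relation.Unary.Any using (here; there)
open import Data.Product using (∃-syntax; _×_; _,_; proj₁; proj₂)
open import Function using (_∘_; id)
open import Relation.Binary.PropositionalEquality
  using (_≡_; refl; sym; trans; cong; cong₂; subst; module ≡-Reasoning)
open import Relation.Nullary using (yes; no; does; contradiction)
open import Relation.Nullary.Decidable using (dec-true; dec-false)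
open import Function.Construct.Identity using (bijective)

χ : Bool → ℕ
χ b = if b then 1 else 0

card : ∀ {n} → (Fin n → Bool) → ℕ
card P = sumFin (χ ∘ P)

χ≤1 : ∀ b → χ b ≤ 1
χ≤1 true  = ≤-refl
χ≤1 false = z≤n

χ-∧ : ∀ a b → χ (a ∧ b) ≡ χ a * χ b
χ-∧ true  b = sym (+-identityʳ (χ b))
χ-∧ false b = refl

χ-∧-≤ : ∀ a {b m} → (a ≡ true → χ b ≤ m) → χ (a ∧ b) ≤ m
χ-∧-≤ true  h = h refl
χ-∧-≤ false h = z≤n

sumFin≡sum : ∀ {n} (f : Fin n → ℕ) → sumFin f ≡ sum f
sumFin≡sum {zero}  f = refl
sumFin≡sum {suc n} f = cong (f fzero +_) (sumFin≡sum (f ∘ fsuc))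

sumFin-cong : ∀ {n} {f g : Fin n → ℕ} → (∀ i → f i ≡ g i) → sumFin f ≡ sumFin g
sumFin-cong {zero}  f≗g = refl
sumFin-cong {suc n} f≗g = cong₂ _+_ (f≗g fzero) (sumFin-cong (f≗g ∘ fsuc))

sumFin-mono : ∀ {n} {f g : Fin n → ℕ} → (∀ i → f i ≤ g i) → sumFin f ≤ sumFin g
sumFin-mono {zero}  f≤g = z≤n
sumFin-mono {suc n} f≤g = +-mono-≤ (f≤g fzero) (sumFin-mono (f≤g ∘ fsuc))

sumFin-zero : ∀ n → sumFin {n} (λ _ → 0) ≡ 0
sumFin-zero zero    = refl
sumFin-zero (suc n) = sumFin-zero n

sumFin-+ : ∀ {n} (f g : Fin n → ℕ) → sumFin (λ i → f i + g i) ≡ sumFin f + sumFin g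
sumFin-+ f g = begin
  sumFin (λ i → f i + g i)  ≡⟨ sumFin≡sum (λ i → f i + g i) ⟩
  sum (λ i → f i + g i)     ≡⟨ ∑-distrib-+ f g ⟩
  sum f + sum g             ≡⟨ cong₂ _+_ (sumFin≡sum f) (sumFin≡sum g) ⟨
  sumFin f + sumFin g       ∎
  where open ≡-Reasoning

*-distribˡ-sumFin : ∀ {n} c (f : Fin n → ℕ) → c * sumFin f ≡ sumFin (λ i → c * f i)
*-distribˡ-sumFin c f = begin
  c * sumFin f            ≡⟨ cong (c *_) (sumFin≡sum f) ⟩
  c * sum f               ≡⟨ *-distribˡ-sum c f ⟩
  sum (λ i → c * f i)     ≡⟨ sumFin≡sum (λ i → c * f i) ⟨
  sumFin (λ i → c * f i)  ∎
  where open ≡-Reasoning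

*-distribʳ-sumFin : ∀ {n} c (f : Fin n → ℕ) → sumFin f * c ≡ sumFin (λ i → f i * c)
*-distribʳ-sumFin c f = begin
  sumFin f * c            ≡⟨ cong (_* c) (sumFin≡sum f) ⟩
  sum f * c               ≡⟨ *-distribʳ-sum c f ⟩
  sum (λ i → f i * c)     ≡⟨ sumFin≡sum (λ i → f i * c) ⟨
  sumFin (λ i → f i * c)  ∎
  where open ≡-Reasoning

sumFin-comm : ∀ {m n} (h : Fin m → Fin n → ℕ) →
  sumFin (λ i → sumFin (h i)) ≡ sumFin (λ j → sumFin (λ i → h i j))
sumFin-comm h = begin
  sumFin (λ i → sumFin (h i))
    ≡⟨ trans (sumFin-cong (sumFin≡sum ∘ h)) (sumFin≡sum (sum ∘ h)) ⟩
  sum (λ i → sum (h i))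
    ≡⟨ ∑-comm h ⟩
  sum (λ j → sum (λ i → h i j))
    ≡⟨ trans (sumFin-cong (λ j → sumFin≡sum (λ i → h i j)))
             (sumFin≡sum (λ j → sum (λ i → h i j))) ⟨
  sumFin (λ j → sumFin (λ i → h i j))
    ∎
  where open ≡-Reasoning

card-full : ∀ n → card {n} (λ _ → true) ≡ n
card-full zero    = refl
card-full (suc n) = cong suc (card-full n)

χ≤card : ∀ {n} (P : Fin n → Bool) x → χ (P x) ≤ card P
χ≤card P fzero    = m≤m+n _ _
χ≤card P (fsuc x) = ≤-trans (χ≤card (P ∘ fsuc) x) (m≤n+m _ _)

sumFin² : ∀ {n} → (Fin n → Fin n → ℕ) → ℕ
sumFin² g = sumFin (λ i → sumFin (g i))

sumFin²-cong : ∀ {n} {g h : Fin n → Fin n → ℕ} →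
  (∀ i j → g i j ≡ h i j) → sumFin² g ≡ sumFin² h
sumFin²-cong g≗h = sumFin-cong (sumFin-cong ∘ g≗h)

sumFin²-mono : ∀ {n} {g h : Fin n → Fin n → ℕ} →
  (∀ i j → g i j ≤ h i j) → sumFin² g ≤ sumFin² h
sumFin²-mono g≤h = sumFin-mono (sumFin-mono ∘ g≤h)

sumFin²-+ : ∀ {n} (g h : Fin n → Fin n → ℕ) →
  sumFin² (λ i j → g i j + h i j) ≡ sumFin² g + sumFin² h
sumFin²-+ g h = trans (sumFin-cong (λ i → sumFin-+ (g i) (h i))) (sumFin-+ (sumFin ∘ g) (sumFin ∘ h))

*-distribˡ-sumFin² : ∀ {n} c (g : Fin n → Fin n → ℕ) →
  c * sumFin² g ≡ sumFin² (λ i j → c * g i j)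
*-distribˡ-sumFin² c g =
  trans (*-distribˡ-sumFin c (sumFin ∘ g)) (sumFin-cong (λ i → *-distribˡ-sumFin c (g i)))

*-distribʳ-sumFin² : ∀ {n} c (g : Fin n → Fin n → ℕ) →
  sumFin² g * c ≡ sumFin² (λ i j → g i j * c)
*-distribʳ-sumFin² c g =
  trans (*-distribʳ-sumFin c (sumFin ∘ g)) (sumFin-cong (λ i → *-distribʳ-sumFin c (g i)))

sumFin²-sumFin-comm : ∀ {k n} (h : Fin n → Fin n → Fin k → ℕ) →
  sumFin² (λ i j → sumFin (h i j)) ≡ sumFin (λ w → sumFin² (λ i j → h i j w))
sumFin²-sumFin-comm h =
  trans (sumFin-cong (sumFin-comm ∘ h)) (sumFin-comm (λ i w → sumFin (λ j → h i j w)))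

sumFin²-zero : ∀ n → sumFin² {n} (λ _ _ → 0) ≡ 0
sumFin²-zero n = trans (sumFin-cong {n} (λ _ → sumFin-zero n)) (sumFin-zero n)

ordered : ∀ {n} → Fin n → Fin n → Bool
ordered i j = toℕ i <ᵇ toℕ j

countPairs-cong : ∀ {n} {P P′ : Fin n → Fin n → Bool} → (∀ i j → P i j ≡ P′ i j) →
  countPairs P ≡ countPairs P′
countPairs-cong P≗P′ = sumFin²-cong (λ i j → cong (λ b → χ (ordered i j ∧ b)) (P≗P′ i j))

χ-∧-+ : ∀ c {a b d} → χ a ≤ χ b + χ d → χ (c ∧ a) ≤ χ (c ∧ b) + χ (c ∧ d)
χ-∧-+ true  h = h
χ-∧-+ false h = z≤n

countPairs-split : ∀ {n} {P P₁ P₂ : Fin n → Fin n → Bool} →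
  (∀ i j → χ (P i j) ≤ χ (P₁ i j) + χ (P₂ i j)) →
  countPairs P ≤ countPairs P₁ + countPairs P₂
countPairs-split {P₁ = P₁} {P₂} h =
  ≤-trans (sumFin²-mono (λ i j → χ-∧-+ (ordered i j) (h i j)))
          (≤-reflexive (sumFin²-+ (λ i j → χ (ordered i j ∧ P₁ i j))
                                  (λ i j → χ (ordered i j ∧ P₂ i j))))

-- If the first vertex lies in D, it already forms a pair with each of the other card D − 1.
card≤countPairs+1 : ∀ {n} (D : Fin n → Bool) → card D ≤ countPairs (λ i j → D i ∧ D j) + 1
card≤countPairs+1 {zero}  D = z≤n
card≤countPairs+1 {suc n} D with D fzero
... | false = ≤-trans (card≤countPairs+1 (D ∘ fsuc)) (+-monoˡ-≤ 1 (m≤n+m _ _))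
... | true  = ≤-trans (≤-reflexive (+-comm 1 _)) (+-monoˡ-≤ 1 (m≤m+n _ _))

deleteVertex : ∀ {n} → Graph (suc n) → Fin (suc n) → Graph n
deleteVertex G w = record
  { adj    = λ i j → adj G (punchIn w i) (punchIn w j)
  ; sym    = λ i j → adj-sym G (punchIn w i) (punchIn w j)
  ; irrefl = λ i → irrefl G (punchIn w i)
  }

deleteVertex-isProperInducedSub : ∀ {n} (G : Graph (suc n)) w → IsProperInducedSub (deleteVertex G w) G
deleteVertex-isProperInducedSub G w = n<1+n _ , punchIn w , punchIn-injective w _ _ , λ i j → refl

avoiding : ∀ {n} → Fin n → (Fin n → Fin n → Bool) → Fin n → Fin n → Bool
avoiding w P i j = not (does (i ≟ w)) ∧ not (does (j ≟ w)) ∧ P i j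

card-punchIn : ∀ {n} (w : Fin (suc n)) (P : Fin (suc n) → Bool) →
  card (P ∘ punchIn w) ≡ card (λ j → not (does (j ≟ w)) ∧ P j)
card-punchIn fzero            P = refl
card-punchIn {suc n} (fsuc w) P = cong (χ (P fzero) +_) (card-punchIn w (P ∘ fsuc))

countPairs-punchIn : ∀ {n} (w : Fin (suc n)) (P : Fin (suc n) → Fin (suc n) → Bool) →
  countPairs (λ i j → P (punchIn w i) (punchIn w j)) ≡ countPairs (avoiding w P)
countPairs-punchIn {n} fzero P = cong (_+ countPairs (λ i j → P (fsuc i) (fsuc j))) (sym (sumFin-zero n))
countPairs-punchIn {suc n} (fsuc w) P =
  cong₂ _+_ (card-punchIn w (λ j → P fzero (fsuc j)))
            (countPairs-punchIn w (λ i j → P (fsuc i) (fsuc j)))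

card-remove : ∀ {n} (w : Fin n) (P : Fin n → Bool) →
  card P ≡ χ (P w) + card (λ j → not (does (j ≟ w)) ∧ P j)
card-remove {suc n} w P = begin
  card P
    ≡⟨ sumFin≡sum (χ ∘ P) ⟩
  sum (χ ∘ P)
    ≡⟨ sum-remove (χ ∘ P) ⟩
  χ (P w) + sum (χ ∘ P ∘ punchIn w)
    ≡⟨ cong (χ (P w) +_) (sumFin≡sum (χ ∘ P ∘ punchIn w)) ⟨
  χ (P w) + card (P ∘ punchIn w)
    ≡⟨ cong (χ (P w) +_) (card-punchIn w P) ⟩
  χ (P w) + card (λ j → not (does (j ≟ w)) ∧ P j)
    ∎
  where open ≡-Reasoning

∧-true : ∀ {a b} → a ∧ b ≡ true → a ≡ true × b ≡ true
∧-true {true} {true} _ = refl , refl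

deviation : ∀ {k n} → (Fin k → Fin n → Bool) → (Fin k → Bool) → (Fin n → Bool) → Fin n → ℕ
deviation S J Y x = card (λ w → J w ∧ (Y x xor S w x))

record QuasiSunflower {k n} (f : ℕ → ℕ) (S : Fin k → Fin n → Bool) (J₀ : Fin k → Bool) : Set where
  field
    core             : Fin n → Bool
    petals           : Fin k → Bool
    spread           : ℕ
    petals⊆J₀        : ∀ w → petals w ≡ true → J₀ w ≡ true
    deviation≤spread : ∀ x → deviation S petals core x ≤ spread
    f[spread]≤card   : f spread ≤ card petals

quasiSunflowerBound : (ℕ → ℕ) → ℕ → ℕ
quasiSunflowerBound f zero    = f 0
quasiSunflowerBound f (suc s) = f (quasiSunflowerBound f s)

-- Either some point x₀ lies in many sets, and we recurse on those sets with x₀ removed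
-- and put x₀ into the core, or no point does, and the empty core works.
quasiSunflower : ∀ {k n} (f : ℕ → ℕ) s (S : Fin k → Fin n → Bool) (J₀ : Fin k → Bool) →
  (∀ w → J₀ w ≡ true → card (S w) ≤ s) → quasiSunflowerBound f s ≤ card J₀ →
  QuasiSunflower f S J₀
quasiSunflower {k} f zero S J₀ small large = record
  { core             = λ _ → false
  ; petals           = J₀
  ; spread           = 0
  ; petals⊆J₀        = λ _ → id
  ; deviation≤spread = λ x →
      ≤-trans (sumFin-mono (λ w → χ-∧-≤ (J₀ w) (≤-trans (χ≤card (S w) x) ∘ small w)))
              (≤-reflexive (sumFin-zero k))
  ; f[spread]≤card   = large
  }
quasiSunflower {k} {n} f (suc s) S J₀ small large
  with any? (λ x → quasiSunflowerBound f s ≤? card (λ w → J₀ w ∧ S w x))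
... | no noHeavyPoint = record
  { core             = λ _ → false
  ; petals           = J₀
  ; spread           = quasiSunflowerBound f s
  ; petals⊆J₀        = λ _ → id
  ; deviation≤spread = λ x → <⇒≤ (≰⇒> (noHeavyPoint ∘ (x ,_)))
  ; f[spread]≤card   = large
  }
... | yes (x₀ , heavy) = record
  { core             = λ x → does (x ≟ x₀) ∨ core x
  ; petals           = petals
  ; spread           = spread
  ; petals⊆J₀        = λ w → proj₁ ∘ ∧-true ∘ petals⊆J₀ w
  ; deviation≤spread = λ x → ≤-trans (sumFin-mono (deviation-mono x)) (deviation≤spread x)
  ; f[spread]≤card   = f[spread]≤card
  }
  where
  J₁ : Fin k → Bool
  J₁ w = J₀ w ∧ S w x₀
  S′ : Fin k → Fin n → Bool
  S′ w x = not (does (x ≟ x₀)) ∧ S w x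

  S′-small : ∀ w → J₁ w ≡ true → card (S′ w) ≤ s
  S′-small w J₁w with ∧-true {J₀ w} J₁w
  ... | J₀w , Swx₀ = s≤s⁻¹ (subst (_≤ suc s) card[Sw]≡1+card[S′w] (small w J₀w))
    where
    card[Sw]≡1+card[S′w] : card (S w) ≡ suc (card (S′ w))
    card[Sw]≡1+card[S′w] = trans (card-remove x₀ (S w)) (cong (λ b → χ b + card (S′ w)) Swx₀)

  open QuasiSunflower (quasiSunflower f s S′ J₁ S′-small heavy)

  deviation-mono : ∀ x w →
    χ (petals w ∧ ((does (x ≟ x₀) ∨ core x) xor S w x)) ≤ χ (petals w ∧ (core x xor S′ w x))
  deviation-mono x w with x ≟ x₀
  ... | no  _    = ≤-refl
  ... | yes refl = χ-∧-≤ (petals w) λ pw →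
    ≤-trans (≤-reflexive (cong (χ ∘ not) (proj₂ (∧-true (petals⊆J₀ w pw))))) z≤n

m*a≤m*r+a*d⇒a≤r : ∀ m a r d → m * a ≤ m * r + a * d → d * suc r < m → a ≤ r
m*a≤m*r+a*d⇒a≤r m a r d ineq large with r <? a
... | no  a≯r = ≮⇒≥ a≯r
... | yes r<a with m≤n⇒∃[o]m+o≡n r<a
...   | e , refl = contradiction m*[1+e]<m*[1+e] (<-irrefl refl)
  where
  open ≤-Reasoning
  m*[1+e]<m*[1+e] : m * suc e < m * suc e
  m*[1+e]<m*[1+e] = begin-strict
    m * suc e          ≤⟨ +-cancelˡ-≤ (m * r) _ _ (≤-trans (≤-reflexive distrib) ineq) ⟩
    (suc r + e) * d    ≤⟨ *-monoˡ-≤ d 1+r+e≤[1+r]*[1+e] ⟩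
    suc r * suc e * d  ≡⟨ trans (*-comm (suc r * suc e) d) (sym (*-assoc d (suc r) (suc e))) ⟩
    d * suc r * suc e  <⟨ *-monoˡ-< (suc e) large ⟩
    m * suc e          ∎
    where
    distrib : m * r + m * suc e ≡ m * (suc r + e)
    distrib = trans (sym (*-distribˡ-+ m r (suc e))) (cong (m *_) (+-suc r e))
    1+r+e≤[1+r]*[1+e] : suc r + e ≤ suc r * suc e
    1+r+e≤[1+r]*[1+e] =
      ≤-trans (+-monoʳ-≤ (suc r) (m≤n*m e (suc r))) (≤-reflexive (sym (*-suc (suc r) e)))

χ-∧-cover : ∀ j b b′ e e′ → (b ≡ true → e ≡ false → e′ ≡ false → b′ ≡ true) →
  χ (j ∧ b) ≤ χ (j ∧ b′) + χ b * (χ (j ∧ e) + χ (j ∧ e′))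
χ-∧-cover false b     b′ e     e′    h = z≤n
χ-∧-cover true  false b′ e     e′    h = z≤n
χ-∧-cover true  true  b′ true  e′    h = ≤-trans (s≤s z≤n) (m≤n+m _ (χ b′))
χ-∧-cover true  true  b′ false true  h = ≤-trans (s≤s z≤n) (m≤n+m _ (χ b′))
χ-∧-cover true  true  b′ false false h rewrite h refl refl refl = s≤s z≤n

-- Double counting the incidences (pair of B, member of J): a pair of B is missed by B′ w only
-- for the at most 2c members w of J having an endpoint of the pair in E w.
countPairs≤-by-averaging : ∀ {k n} (B : Fin n → Fin n → Bool) (B′ : Fin k → Fin n → Fin n → Bool)
  (E : Fin k → Fin n → Bool) (J : Fin k → Bool) {r c : ℕ} →
  (∀ w i j → B i j ≡ true → E w i ≡ false → E w j ≡ false → B′ w i j ≡ true) →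
  (∀ w → J w ≡ true → countPairs (B′ w) ≤ r) →
  (∀ x → card (λ w → J w ∧ E w x) ≤ c) →
  2 * c * suc r < card J →
  countPairs B ≤ r
countPairs≤-by-averaging {k} {n} B B′ E J {r} {c} B⇒B′ B′-few E-rare large =
  m*a≤m*r+a*d⇒a≤r (card J) (countPairs B) r (2 * c) doubleCount large
  where
  open ≤-Reasoning
  b : Fin n → Fin n → Bool
  b i j = ordered i j ∧ B i j
  b′ : Fin k → Fin n → Fin n → Bool
  b′ w i j = ordered i j ∧ B′ w i j
  kept : Fin n → Fin n → Fin k → ℕ
  kept i j w = χ (J w ∧ b′ w i j)
  exceptional : Fin n → Fin k → ℕ
  exceptional x w = χ (J w ∧ E w x)

  b⇒b′ : ∀ w i j → b i j ≡ true → E w i ≡ false → E w j ≡ false → b′ w i j ≡ true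
  b⇒b′ w i j bij with ordered i j | bij
  ... | true | Bij = B⇒B′ w i j Bij

  perPair : ∀ i j → card J * χ (b i j) ≤ sumFin (kept i j) + χ (b i j) * (2 * c)
  perPair i j = begin
    card J * χ (b i j)
      ≡⟨ *-distribʳ-sumFin (χ (b i j)) (χ ∘ J) ⟩
    sumFin (λ w → χ (J w) * χ (b i j))
      ≡⟨ sumFin-cong (λ w → χ-∧ (J w) (b i j)) ⟨
    sumFin (λ w → χ (J w ∧ b i j))
      ≤⟨ sumFin-mono (λ w → χ-∧-cover (J w) (b i j) (b′ w i j) (E w i) (E w j) (b⇒b′ w i j)) ⟩
    sumFin (λ w → kept i j w + χ (b i j) * (exceptional i w + exceptional j w))
      ≡⟨ sumFin-+ (kept i j) (λ w → χ (b i j) * (exceptional i w + exceptional j w)) ⟩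
    sumFin (kept i j) + sumFin (λ w → χ (b i j) * (exceptional i w + exceptional j w))
      ≡⟨ cong (sumFin (kept i j) +_)
              (*-distribˡ-sumFin (χ (b i j)) (λ w → exceptional i w + exceptional j w)) ⟨
    sumFin (kept i j) + χ (b i j) * sumFin (λ w → exceptional i w + exceptional j w)
      ≡⟨ cong (λ t → sumFin (kept i j) + χ (b i j) * t) (sumFin-+ (exceptional i) (exceptional j)) ⟩
    sumFin (kept i j) + χ (b i j) * (sumFin (exceptional i) + sumFin (exceptional j))
      ≤⟨ +-monoʳ-≤ _ (*-monoʳ-≤ (χ (b i j)) (+-mono-≤ (E-rare i) (E-rare j))) ⟩
    sumFin (kept i j) + χ (b i j) * (c + c)
      ≡⟨ cong (λ t → sumFin (kept i j) + χ (b i j) * (c + t)) (+-identityʳ c) ⟨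
    sumFin (kept i j) + χ (b i j) * (2 * c)
      ∎

  perWitness : ∀ w → sumFin² (λ i j → kept i j w) ≤ χ (J w) * r
  perWitness w with J w in Jw
  ... | true  = ≤-trans (B′-few w Jw) (≤-reflexive (sym (+-identityʳ r)))
  ... | false = ≤-reflexive (sumFin²-zero n)

  doubleCount : card J * countPairs B ≤ card J * r + countPairs B * (2 * c)
  doubleCount = begin
    card J * countPairs B
      ≡⟨ *-distribˡ-sumFin² (card J) (λ i j → χ (b i j)) ⟩
    sumFin² (λ i j → card J * χ (b i j))
      ≤⟨ sumFin²-mono perPair ⟩
    sumFin² (λ i j → sumFin (kept i j) + χ (b i j) * (2 * c))
      ≡⟨ sumFin²-+ (λ i j → sumFin (kept i j)) (λ i j → χ (b i j) * (2 * c)) ⟩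
    sumFin² (λ i j → sumFin (kept i j)) + sumFin² (λ i j → χ (b i j) * (2 * c))
      ≡⟨ cong₂ _+_ (sumFin²-sumFin-comm kept) (sym (*-distribʳ-sumFin² (2 * c) (λ i j → χ (b i j)))) ⟩
    sumFin (λ w → sumFin² (λ i j → kept i j w)) + countPairs B * (2 * c)
      ≤⟨ +-monoˡ-≤ _ (sumFin-mono perWitness) ⟩
    sumFin (λ w → χ (J w) * r) + countPairs B * (2 * c)
      ≡⟨ cong (_+ countPairs B * (2 * c)) (*-distribʳ-sumFin r (χ ∘ J)) ⟨
    card J * r + countPairs B * (2 * c)
      ∎

-- EdgeSplit p q G unfolds to
--   Σ V, countPairs (sidePairs nonEdge₁ G V) ≤ p × countPairs (sidePairs edge₂ G V) ≤ q.
sidePairs : ∀ {n} → (Bool → Bool → Bool → Bool) → Graph n → (Fin n → Bool) → Fin n → Fin n → Bool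
sidePairs β G V i j = β (V i) (V j) (adj G i j)

nonEdge₁ edge₂ : Bool → Bool → Bool → Bool
nonEdge₁ a b e = a ∧ b ∧ not e
edge₂    a b e = not a ∧ not b ∧ e

SplitsAvoiding : ∀ {n} → ℕ → ℕ → Graph n → Fin n → (Fin n → Bool) → Set
SplitsAvoiding p q G w V =
  countPairs (avoiding w (sidePairs nonEdge₁ G V)) ≤ p × countPairs (avoiding w (sidePairs edge₂ G V)) ≤ q

splitsAvoiding-deleteVertex : ∀ {p q n} (G : Graph (suc n)) w →
  EdgeSplit p q (deleteVertex G w) → ∃[ V ] SplitsAvoiding p q G w V
splitsAvoiding-deleteVertex G w (V , few₁ , few₂) =
  insertAt V w false , lift nonEdge₁ few₁ , lift edge₂ few₂
  where
  lift : ∀ β {r} → countPairs (sidePairs β (deleteVertex G w) V) ≤ r →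
    countPairs (avoiding w (sidePairs β G (insertAt V w false))) ≤ r
  lift β few = ≤-trans (≤-reflexive (trans (sym (countPairs-punchIn w (sidePairs β G (insertAt V w false))))
                                           (countPairs-cong restrict)))
                       few
    where
    restrict : ∀ i j → sidePairs β G (insertAt V w false) (punchIn w i) (punchIn w j)
                     ≡ sidePairs β (deleteVertex G w) V i j
    restrict i j = cong₂ (λ a b → β a b _) (insertAt-punchIn V w false i) (insertAt-punchIn V w false j)

χ-pairInDifference : ∀ u v a b u′ v′ a′ b′ e →
  χ ((not u ∧ not v ∧ a ∧ not b) ∧ (not u′ ∧ not v′ ∧ a′ ∧ not b′)) ≤
  χ (not u ∧ not u′ ∧ a ∧ a′ ∧ not e) + χ (not v ∧ not v′ ∧ not b ∧ not b′ ∧ e)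
χ-pairInDifference true  _     _     _     _     _     _     _     _     = z≤n
χ-pairInDifference false true  _     _     _     _     _     _     _     = z≤n
χ-pairInDifference false false false _     _     _     _     _     _     = z≤n
χ-pairInDifference false false true  true  _     _     _     _     _     = z≤n
χ-pairInDifference false false true  false true  _     _     _     _     = z≤n
χ-pairInDifference false false true  false false true  _     _     _     = z≤n
χ-pairInDifference false false true  false false false false _     _     = z≤n
χ-pairInDifference false false true  false false false true  true  _     = z≤n
χ-pairInDifference false false true  false false false true  false false = s≤s z≤n
χ-pairInDifference false false true  false false false true  false true  = s≤s z≤n

-- Two vertices of the difference span a non-edge inside V or an edge outside V′.
card-sideDifference≤ : ∀ {n} (G : Graph n) {w w′ : Fin n} {V V′ : Fin n → Bool} {p q} →
  countPairs (avoiding w (sidePairs nonEdge₁ G V)) ≤ p →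
  countPairs (avoiding w′ (sidePairs edge₂ G V′)) ≤ q →
  card (λ x → not (does (x ≟ w)) ∧ not (does (x ≟ w′)) ∧ V x ∧ not (V′ x)) ≤ p + q + 1
card-sideDifference≤ {n} G {w} {w′} {V} {V′} few₁ few₂ =
  ≤-trans (card≤countPairs+1 D)
          (+-monoˡ-≤ 1 (≤-trans (countPairs-split pairInDifference) (+-mono-≤ few₁ few₂)))
  where
  D : Fin n → Bool
  D x = not (does (x ≟ w)) ∧ not (does (x ≟ w′)) ∧ V x ∧ not (V′ x)
  pairInDifference : ∀ i j → χ (D i ∧ D j) ≤
    χ (avoiding w (sidePairs nonEdge₁ G V) i j) + χ (avoiding w′ (sidePairs edge₂ G V′) i j)
  pairInDifference i j = χ-pairInDifference (does (i ≟ w)) (does (i ≟ w′)) (V i) (V′ i)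
                                             (does (j ≟ w)) (does (j ≟ w′)) (V j) (V′ j) (adj G i j)

card-singleton : ∀ {n} (w : Fin n) → card (λ x → does (x ≟ w)) ≡ 1
card-singleton {suc n} fzero    = cong suc (sumFin-zero n)
card-singleton {suc n} (fsuc w) = card-singleton w

card-singleton′ : ∀ {n} (x : Fin n) → card (λ w → does (x ≟ w)) ≡ 1
card-singleton′ {suc n} fzero    = cong suc (sumFin-zero n)
card-singleton′ {suc n} (fsuc x) = card-singleton′ x

χ-xor≤ : ∀ u v a b →
  χ (a xor b) ≤ χ u + χ v + χ (not u ∧ not v ∧ a ∧ not b) + χ (not v ∧ not u ∧ b ∧ not a)
χ-xor≤ true  v     a     b     = ≤-trans (χ≤1 (a xor b)) (s≤s z≤n)
χ-xor≤ false true  a     b     = ≤-trans (χ≤1 (a xor b)) (s≤s z≤n)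
χ-xor≤ false false true  true  = z≤n
χ-xor≤ false false true  false = s≤s z≤n
χ-xor≤ false false false true  = s≤s z≤n
χ-xor≤ false false false false = z≤n

differenceBound : ℕ → ℕ → ℕ
differenceBound p q = 2 + (p + q + 1) + (p + q + 1)

card-xor≤ : ∀ {n p q} (G : Graph n) {w w′ : Fin n} {V V′ : Fin n → Bool} →
  SplitsAvoiding p q G w V → SplitsAvoiding p q G w′ V′ →
  card (λ x → V x xor V′ x) ≤ differenceBound p q
card-xor≤ {n} {p} {q} G {w} {w′} {V} {V′} (few₁ , few₂) (few₁′ , few₂′) = begin
  card (λ x → V x xor V′ x)
    ≤⟨ sumFin-mono (λ x → χ-xor≤ (does (x ≟ w)) (does (x ≟ w′)) (V x) (V′ x)) ⟩
  sumFin (λ x → χ (u x) + χ (v x) + χ (D x) + χ (D′ x))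
    ≡⟨ trans (sumFin-+ (λ x → χ (u x) + χ (v x) + χ (D x)) (χ ∘ D′))
             (cong (_+ card D′) (trans (sumFin-+ (λ x → χ (u x) + χ (v x)) (χ ∘ D))
                                       (cong (_+ card D) (sumFin-+ (χ ∘ u) (χ ∘ v))))) ⟩
  card u + card v + card D + card D′
    ≤⟨ +-mono-≤ (+-mono-≤ (≤-reflexive (cong₂ _+_ (card-singleton w) (card-singleton w′)))
                          (card-sideDifference≤ G {w} {w′} {V} {V′} few₁ few₂′))
                (card-sideDifference≤ G {w′} {w} {V′} {V} few₁′ few₂) ⟩
  differenceBound p q
    ∎
  where
  open ≤-Reasoning
  u v D D′ : Fin n → Bool
  u x  = does (x ≟ w)
  v x  = does (x ≟ w′)
  D x  = not (u x) ∧ not (v x) ∧ V x ∧ not (V′ x)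
  D′ x = not (v x) ∧ not (u x) ∧ V′ x ∧ not (V x)

∨-xor-false : ∀ {a b c} → a ∨ (b xor c) ≡ false → a ≡ false × b ≡ c
∨-xor-false {false} {false} {false} _ = refl , refl
∨-xor-false {false} {true}  {true}  _ = refl , refl

sidePairs-unexceptional : ∀ {n} β (G : Graph n) (V Q : Fin n → Bool) w i j →
  sidePairs β G Q i j ≡ true →
  does (i ≟ w) ∨ (Q i xor V i) ≡ false → does (j ≟ w) ∨ (Q j xor V j) ≡ false →
  avoiding w (sidePairs β G V) i j ≡ true
sidePairs-unexceptional β G V Q w i j Qij i∉E j∉E = begin
  not (does (i ≟ w)) ∧ not (does (j ≟ w)) ∧ β (V i) (V j) (adj G i j)
    ≡⟨ cong₂ (λ a b → not a ∧ not b ∧ β (V i) (V j) (adj G i j)) (proj₁ i-ok) (proj₁ j-ok) ⟩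
  β (V i) (V j) (adj G i j)
    ≡⟨ cong₂ (λ a b → β a b (adj G i j)) (proj₂ i-ok) (proj₂ j-ok) ⟨
  β (Q i) (Q j) (adj G i j)
    ≡⟨ Qij ⟩
  true
    ∎
  where
  open ≡-Reasoning
  i-ok : does (i ≟ w) ≡ false × Q i ≡ V i
  i-ok = ∨-xor-false {does (i ≟ w)} i∉E
  j-ok : does (j ≟ w) ≡ false × Q j ≡ V j
  j-ok = ∨-xor-false {does (j ≟ w)} j∉E

χ-∧-∨ : ∀ j e d → χ (j ∧ (e ∨ d)) ≤ χ (j ∧ d) + χ e
χ-∧-∨ false e     d = z≤n
χ-∧-∨ true  true  d = m≤n+m 1 (χ d)
χ-∧-∨ true  false d = m≤m+n (χ d) 0

-- Enough petals for countPairs≤-by-averaging with r ≤ p + q when every vertex is exceptional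
-- for at most suc c of them.
petalsNeeded : ℕ → ℕ → ℕ → ℕ
petalsNeeded p q c = suc (2 * suc c * suc (p + q))

orderBound : ℕ → ℕ → ℕ
orderBound p q = quasiSunflowerBound (petalsNeeded p q) (differenceBound p q)

edgeSplit-from-deletions : ∀ p q {n} (G : Graph (suc n)) →
  (∀ w → EdgeSplit p q (deleteVertex G w)) → orderBound p q ≤ suc n → EdgeSplit p q G
edgeSplit-from-deletions p q {n} G split large =
  Q , fewPairs nonEdge₁ proj₁ (m≤m+n p q) , fewPairs edge₂ proj₂ (m≤n+m q p)
  where
  V : Fin (suc n) → Fin (suc n) → Bool
  V w = proj₁ (splitsAvoiding-deleteVertex G w (split w))
  V-splits : ∀ w → SplitsAvoiding p q G w (V w)
  V-splits w = proj₂ (splitsAvoiding-deleteVertex G w (split w))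
  S : Fin (suc n) → Fin (suc n) → Bool
  S w x = V fzero x xor V w x

  sunflower : QuasiSunflower (petalsNeeded p q) S (λ _ → true)
  sunflower = quasiSunflower (petalsNeeded p q) (differenceBound p q) S (λ _ → true)
    (λ w _ → card-xor≤ G {fzero} {w} {V fzero} {V w} (V-splits fzero) (V-splits w))
    (subst (orderBound p q ≤_) (sym (card-full (suc n))) large)
  open QuasiSunflower sunflower

  Q : Fin (suc n) → Bool
  Q x = core x xor V fzero x
  E : Fin (suc n) → Fin (suc n) → Bool
  E w x = does (x ≟ w) ∨ (Q x xor V w x)

  E-rare : ∀ x → card (λ w → petals w ∧ E w x) ≤ suc spread
  E-rare x = begin
    card (λ w → petals w ∧ E w x)
      ≤⟨ sumFin-mono (λ w → χ-∧-∨ (petals w) (does (x ≟ w)) (Q x xor V w x)) ⟩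
    sumFin (λ w → χ (petals w ∧ (Q x xor V w x)) + χ (does (x ≟ w)))
      ≡⟨ sumFin-+ (λ w → χ (petals w ∧ (Q x xor V w x))) (λ w → χ (does (x ≟ w))) ⟩
    card (λ w → petals w ∧ (Q x xor V w x)) + card (λ w → does (x ≟ w))
      ≡⟨ cong₂ _+_ (sumFin-cong λ w → cong (λ t → χ (petals w ∧ t)) (xor-assoc (core x) (V fzero x) (V w x)))
                   (card-singleton′ x) ⟩
    deviation S petals core x + 1
      ≤⟨ +-monoˡ-≤ 1 (deviation≤spread x) ⟩
    spread + 1
      ≡⟨ +-comm spread 1 ⟩
    suc spread
      ∎
    where open ≤-Reasoning

  fewPairs : ∀ β {r} →
    (∀ {w} → SplitsAvoiding p q G w (V w) → countPairs (avoiding w (sidePairs β G (V w))) ≤ r) →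
    r ≤ p + q → countPairs (sidePairs β G Q) ≤ r
  fewPairs β select r≤p+q =
    countPairs≤-by-averaging (sidePairs β G Q) (λ w → avoiding w (sidePairs β G (V w))) E petals
      (λ w → sidePairs-unexceptional β G (V w) Q w) (λ w _ → select {w} (V-splits w)) E-rare
      (≤-<-trans (*-monoʳ-≤ (2 * suc spread) (s≤s r≤p+q)) f[spread]≤card)

forbidden-order< : ∀ p q {n} (G : Graph n) → IsForbidden (EdgeSplit p q) G → n < orderBound p q
forbidden-order< p q {zero}  G _                      = s≤s z≤n
forbidden-order< p q {suc n} G (notSplit , minimal) =
  ≰⇒> (notSplit ∘ edgeSplit-from-deletions p q G
         (λ w → minimal (deleteVertex G w) (deleteVertex-isProperInducedSub G w)))

vectors : ∀ {A : Set} k → List A → List (Vector A k)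
vectors zero    xs = [ (λ ()) ]
vectors (suc k) xs = cartesianProductWith Vector._∷_ xs (vectors k xs)

vectors-complete : ∀ {A B : Set} (R : A → B → Set) k (xs : List A) (f : Vector B k) →
  (∀ i → ∃[ a ] a ∈ xs × R a (f i)) → ∃[ g ] g ∈ vectors k xs × (∀ i → R (g i) (f i))
vectors-complete R zero    xs f covered = (λ ()) , here refl , λ ()
vectors-complete R (suc k) xs f covered
  with covered fzero | vectors-complete R k xs (f ∘ fsuc) (covered ∘ fsuc)
... | a , a∈xs , Ra | g , g∈vs , Rg =
  a Vector.∷ g , ∈-cartesianProductWith⁺ Vector._∷_ a∈xs g∈vs , λ { fzero → Ra ; (fsuc i) → Rg i }

does-≟-sym : ∀ {n} (i j : Fin n) → does (i ≟ j) ≡ does (j ≟ i)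
does-≟-sym i j with i ≟ j
... | yes refl = sym (dec-true (i ≟ i) refl)
... | no  i≢j  = sym (dec-false (j ≟ i) (i≢j ∘ sym))

fromRelation : ∀ {n} → (Fin n → Fin n → Bool) → Graph n
fromRelation M = record
  { adj    = λ i j → (M i j ∧ M j i) ∧ not (does (i ≟ j))
  ; sym    = λ i j → cong₂ _∧_ (∧-comm (M i j) (M j i)) (cong not (does-≟-sym i j))
  ; irrefl = λ i → trans (cong (λ b → (M i i ∧ M i i) ∧ not b) (dec-true (i ≟ i) refl)) (∧-zeroʳ _)
  }

fromRelation-adj : ∀ {n} (G : Graph n) (M : Fin n → Fin n → Bool) → (∀ i j → M i j ≡ adj G i j) →
  ∀ i j → adj (fromRelation M) i j ≡ adj G i j
fromRelation-adj G M M≗G i j rewrite M≗G i j | M≗G j i with i ≟ j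
... | yes refl = trans (∧-zeroʳ _) (sym (irrefl G i))
... | no  _    = trans (∧-identityʳ _) (trans (cong (adj G i j ∧_) (adj-sym G j i)) (∧-idem (adj G i j)))

bools : List Bool
bools = true ∷ false ∷ []

∈-bools : ∀ b → b ∈ bools
∈-bools true  = here refl
∈-bools false = there (here refl)

graphsOfOrder : ∀ n → List (Graph n)
graphsOfOrder n = map fromRelation (vectors n (vectors n bools))

graphsOfOrder-complete : ∀ {n} (G : Graph n) → ∃[ H ] H ∈ graphsOfOrder n × G ≅ H
graphsOfOrder-complete {n} G =
  let M , M∈ , M≗G = vectors-complete (λ r s → ∀ j → r j ≡ s j) n (vectors n bools) (adj G) row
  in fromRelation M , ∈-map⁺ fromRelation M∈ , id , bijective _≡_ , fromRelation-adj G M M≗G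
  where
  row : ∀ i → ∃[ r ] r ∈ vectors n bools × (∀ j → r j ≡ adj G i j)
  row i = vectors-complete _≡_ n bools (adj G i) (λ j → adj G i j , ∈-bools (adj G i j) , refl)

graphsUpTo : ℕ → List AnyGraph
graphsUpTo N = concatMap (λ n → map (n ,_) (graphsOfOrder n)) (upTo (suc N))

graphsUpTo-complete : ∀ {n N} → n ≤ N → (G : Graph n) → ∃[ H ] H ∈ graphsUpTo N × G ≅ proj₂ H
graphsUpTo-complete {n} n≤N G with graphsOfOrder-complete G
... | H , H∈ , G≅H =
  (n , H) ,
  ∈-concatMap⁺ (λ m → map (m ,_) (graphsOfOrder m)) (lose (∈-upTo⁺ (s≤s n≤N)) (∈-map⁺ (n ,_) H∈)) ,
  G≅H

finitelyManyForbidden-if-orderBounded : ∀ (C : GraphClass) N →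
  (∀ {n} (G : Graph n) → IsForbidden C G → n ≤ N) → FinitelyManyForbidden C
finitelyManyForbidden-if-orderBounded C N bounded =
  graphsUpTo N , λ G forbidden → graphsUpTo-complete (bounded G forbidden) G

theorem1p8 : (p q : ℕ) → FinitelyManyForbidden (EdgeSplit p q)
theorem1p8 p q = finitelyManyForbidden-if-orderBounded (EdgeSplit p q) (orderBound p q)
  (λ G forbidden → <⇒≤ (forbidden-order< p q G forbidden))
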